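{- Suppose $H$ is a quotient graph of a finite simple graph $G$. Then there exists a subgraph $G'\subseteq G$ such that $|E(G')|=|E(H)|$ and $H$ is a quotient graph of $G'$.
   Context: A quotient graph $Q$ of $G$ is obtained from a partition of $V(G)$: its vertices are the classes $[v]$, and $\{[u],[v]\}\in E(Q)$ iff $[u]\neq[v]$ and there is an edge $\{u',v'\}\in E(G)$ with $u'\in[u]$, $v'\in[v]$ (loops and multiple edges are discarded). -}

module Defs where

open import Data.Nat using (ℕ)
open import Data.Bool using (Bool; true; false; T)
open import Data.Fin using (Fin; _<?_)
open import Data.Fin.Properties using (all?)
open import Data.List using (List; length; filter; allFin; cartesianProduct)
open import Data.Product using (Σ; ∃; ∃-syntax; _×_; _,_)
open import Relation.Binary.PropositionalEquality using (_≡_; _≢_)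
open import Relation.Nullary using (Dec)
open import Relation.Nullary.Decidable using (_×-dec_)
open import Function.Definitions using (Injective; Surjective)
open import Function using (_⇔_)

record Graph : Set where
  field
    n      : ℕ
    adj    : Fin n → Fin n → Bool
    sym    : ∀ u v → adj u v ≡ adj v u
    irrefl : ∀ u → adj u u ≡ false
open Graph public

Edge : (G : Graph) → Fin (n G) → Fin (n G) → Set
Edge G u v = T (adj G u v)

numEdges : Graph → ℕ
numEdges G =
  length (filter (λ { (u , v) → (u <? v) ×-dec Data.Bool.T? (adj G u v) })
                 (cartesianProduct (allFin (n G)) (allFin (n G))))

-- G' is (isomorphic to) a subgraph of G: an injective vertex map f
-- carrying edges of G' to edges of G.
IsSubgraph : Graph → Graph → Set
IsSubgraph G' G =
  Σ (Fin (n G') → Fin (n G)) λ f →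
    Injective _≡_ _≡_ f × (∀ u v → Edge G' u v → Edge G (f u) (f v))

-- H is (isomorphic to) a quotient graph of G: there is a partition of V(G)
-- whose classes are identified with V(H) via a surjection p : V(G) → V(H)
-- (class of v = fibre p⁻¹(p v)), and [a],[b] are adjacent in H iff they are
-- distinct and some edge of G joins a vertex of [a] to a vertex of [b].
IsQuotient : Graph → Graph → Set
IsQuotient H G =
  Σ (Fin (n G) → Fin (n H)) λ p →
    Surjective _≡_ _≡_ p ×
    (∀ a b → Edge H a b ⇔
       (a ≢ b × ∃[ u ] ∃[ v ] (p u ≡ a × p v ≡ b × Edge G u v)))

{-# OPTIONS --safe #-}
-- Let p : V(G) → V(H) be the quotient map. For every pair of classes a < b that
-- are adjacent in H, pick one edge of G from class a to class b, and let G′ be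
-- the spanning subgraph of G consisting of exactly these edges. Every adjacency
-- of H is still witnessed in G′, so H is a quotient of G′ via the same p, and
-- {u, v} ↦ {p u, p v} is a bijection from E(G′) to E(H) whose inverse sends a
-- pair of classes to its chosen edge.
module Submission where

open import Defs
open import Data.Bool using (T; _∨_; T?)
import Data.Bool.Properties as Bool
open import Data.Empty using (⊥-elim)
open import Data.Fin using (Fin; zero; suc; _<_; _≟_; _<?_)
open import Data.Fin.Properties using (<-cmp; <-irrefl; <-asym; <⇒≢; any?; injective⇒≤)
open import Data.List using (List; length; lookup; filter; allFin; cartesianProduct)
open import Data.List.Membership.Propositional using (_∈_)
open import Data.List.Membership.Propositional.Properties
  using (∈-lookup; ∈-filter⁻; ∈-filter⁺; ∈-allFin; ∈-cartesianProduct⁺)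
open import Data.List.Membership.Setoid.Properties using (index-injective)
import Data.List.Relation.Unary.All as All
open import Data.List.Relation.Unary.AllPairs using (_∷_)
open import Data.List.Relation.Unary.Any using (index)
open import Data.List.Relation.Unary.Unique.Propositional using (Unique)
import Data.List.Relation.Unary.Unique.Propositional.Properties as Unique
open import Data.Nat using (ℕ; _≤_)
open import Data.Nat.Properties using (≤-antisym)
open import Data.Product using (Σ; ∃-syntax; _×_; _,_; proj₁; proj₂)
import Data.Product.Properties as Product
open import Data.Sum using (_⊎_; inj₁; inj₂)
import Data.Sum as Sum
open import Function using (_⇔_; mk⇔; Equivalence; _∘_)
open import Function.Definitions using (Surjective)
open import Relation.Binary using (tri<; tri≈; tri>)
open import Relation.Binary.PropositionalEquality
  using (_≡_; _≢_; refl; trans; cong; subst; setoid)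
import Relation.Binary.PropositionalEquality as ≡
open ≡.≡-Reasoning
open import Relation.Nullary using (Dec; yes; no; ¬_)
open import Relation.Nullary.Decidable
  using (_×-dec_; ⌊_⌋; toWitness; fromWitness; isYes≗does; dec-false)
open import Relation.Unary using (Pred)
open import Level using (0ℓ)

module _ {A : Set} where

  lookup-injective : ∀ {xs : List A} → Unique xs → ∀ i j → lookup xs i ≡ lookup xs j → i ≡ j
  lookup-injective (_ ∷ _)  zero    zero    _  = refl
  lookup-injective (x∉ ∷ _) zero    (suc j) eq = ⊥-elim (All.lookup x∉ (∈-lookup j) eq)
  lookup-injective (x∉ ∷ _) (suc i) zero    eq = ⊥-elim (All.lookup x∉ (∈-lookup i) (≡.sym eq))
  lookup-injective (_ ∷ u)  (suc i) (suc j) eq = cong suc (lookup-injective u i j eq)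

module _ {A B : Set} where

  injectiveOn⇒length≤ : ∀ {xs : List A} {ys : List B} → Unique xs → (f : A → B) →
    (∀ {x} → x ∈ xs → f x ∈ ys) →
    (∀ {x y} → x ∈ xs → y ∈ xs → f x ≡ f y → x ≡ y) →
    length xs ≤ length ys
  injectiveOn⇒length≤ {xs} {ys} uxs f into inj = injective⇒≤ {f = position} position-injective
    where
    position : Fin (length xs) → Fin (length ys)
    position i = index (into (∈-lookup i))

    position-injective : ∀ {i j} → position i ≡ position j → i ≡ j
    position-injective {i} {j} eq =
      lookup-injective uxs i j (inj (∈-lookup i) (∈-lookup j)
        (index-injective (setoid B) (into (∈-lookup i)) (into (∈-lookup j)) eq))

  module _ {P : Pred A 0ℓ} {Q : Pred B 0ℓ} (P? : ∀ x → Dec (P x)) (Q? : ∀ y → Dec (Q y)) where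

    length-filter-≤ : ∀ {xs ys} → Unique xs → (f : A → B) (g : B → A) →
      (∀ {x} → x ∈ xs → P x → f x ∈ ys × Q (f x)) →
      (∀ {x} → x ∈ xs → P x → g (f x) ≡ x) →
      length (filter P? xs) ≤ length (filter Q? ys)
    length-filter-≤ {xs} {ys} uxs f g maps-to g∘f =
      injectiveOn⇒length≤ (Unique.filter⁺ P? uxs) f into injective
      where
      into : ∀ {x} → x ∈ filter P? xs → f x ∈ filter Q? ys
      into x∈ = let (x∈xs , px) = ∈-filter⁻ P? x∈ ; (fx∈ys , qfx) = maps-to x∈xs px
                in ∈-filter⁺ Q? fx∈ys qfx

      injective : ∀ {x y} → x ∈ filter P? xs → y ∈ filter P? xs → f x ≡ f y → x ≡ y
      injective x∈ y∈ eq =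
        let (x∈xs , px) = ∈-filter⁻ P? x∈ ; (y∈xs , py) = ∈-filter⁻ P? y∈
        in trans (≡.sym (g∘f x∈xs px)) (trans (cong g eq) (g∘f y∈xs py))

module _ {A B : Set} {P : Pred A 0ℓ} {Q : Pred B 0ℓ}
         (P? : ∀ x → Dec (P x)) (Q? : ∀ y → Dec (Q y)) where

  length-filter-≡ : ∀ {xs ys} → Unique xs → Unique ys → (f : A → B) (g : B → A) →
    (∀ {x} → x ∈ xs → P x → f x ∈ ys × Q (f x)) →
    (∀ {x} → x ∈ xs → P x → g (f x) ≡ x) →
    (∀ {y} → y ∈ ys → Q y → g y ∈ xs × P (g y)) →
    (∀ {y} → y ∈ ys → Q y → f (g y) ≡ y) →
    length (filter P? xs) ≡ length (filter Q? ys)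
  length-filter-≡ uxs uys f g f-maps g∘f g-maps f∘g = ≤-antisym
    (length-filter-≤ P? Q? uxs f g f-maps g∘f)
    (length-filter-≤ Q? P? uys g f g-maps f∘g)

sort₂ : ∀ {n} → Fin n × Fin n → Fin n × Fin n
sort₂ (x , y) with <-cmp x y
... | tri> _ _ _ = y , x
... | _          = x , y

sort₂-< : ∀ {n} {x y : Fin n} → x < y → sort₂ (x , y) ≡ (x , y)
sort₂-< {x = x} {y} x<y with <-cmp x y
... | tri< _ _ _   = refl
... | tri≈ _ _ _   = refl
... | tri> _ _ y<x = ⊥-elim (<-asym x<y y<x)

sort₂-> : ∀ {n} {x y : Fin n} → y < x → sort₂ (x , y) ≡ (y , x)
sort₂-> {x = x} {y} y<x with <-cmp x y
... | tri< x<y _ _ = ⊥-elim (<-asym x<y y<x)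
... | tri≈ _ x≡y _ = ⊥-elim (<⇒≢ y<x (≡.sym x≡y))
... | tri> _ _ _   = refl

module _ {m : ℕ} {R : Fin m → Fin m → Set}
         (R? : ∀ u v → Dec (R u v)) (R-irrefl : ∀ u → ¬ R u u) where

  symmetricClosure : Graph
  symmetricClosure = record
    { n      = m
    ; adj    = λ u v → ⌊ R? u v ⌋ ∨ ⌊ R? v u ⌋
    ; sym    = λ u v → Bool.∨-comm ⌊ R? u v ⌋ ⌊ R? v u ⌋
    ; irrefl = λ u → cong (λ b → b ∨ b)
                 (trans (isYes≗does (R? u u)) (dec-false (R? u u) (R-irrefl u)))
    }

  Edge-symmetricClosure : ∀ {u v} → Edge symmetricClosure u v ⇔ (R u v ⊎ R v u)
  Edge-symmetricClosure {u} {v} = mk⇔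
    (Sum.map (toWitness {a? = R? u v}) (toWitness {a? = R? v u}) ∘ Equivalence.to Bool.T-∨)
    (Equivalence.from Bool.T-∨ ∘ Sum.map (fromWitness {a? = R? u v}) (fromWitness {a? = R? v u}))

module RepresentativeEdges (G H : Graph) (quotient : IsQuotient H G) where

  p : Fin (n G) → Fin (n H)
  p = proj₁ quotient

  p-surjective : Surjective _≡_ _≡_ p
  p-surjective = proj₁ (proj₂ quotient)

  ClassEdge : Fin (n H) → Fin (n H) → Fin (n G) → Fin (n G) → Set
  ClassEdge a b u v = p u ≡ a × p v ≡ b × Edge G u v

  EdgeH⇔ClassEdge : ∀ a b → Edge H a b ⇔ (a ≢ b × ∃[ u ] ∃[ v ] ClassEdge a b u v)
  EdgeH⇔ClassEdge = proj₂ (proj₂ quotient)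

  classEdge? : ∀ a b u v → Dec (ClassEdge a b u v)
  classEdge? a b u v = (p u ≟ a) ×-dec (p v ≟ b) ×-dec T? (adj G u v)

  representative : Fin (n H) → Fin (n H) → Fin (n G) × Fin (n G)
  representative a b with any? (λ u → any? (classEdge? a b u))
  ... | yes (u , v , _) = u , v
  -- Junk when a and b are not joined; Selected below demands a genuine edge of
  -- G, so it is never selected.
  ... | no _            = let u = proj₁ (p-surjective a) in u , u

  representative-classEdge : ∀ {a b u v} → ClassEdge a b u v →
    ClassEdge a b (proj₁ (representative a b)) (proj₂ (representative a b))
  representative-classEdge {a} {b} {u} {v} c with any? (λ u → any? (classEdge? a b u))
  ... | yes (_ , _ , c′) = c′
  ... | no no-edge       = ⊥-elim (no-edge (u , v , c))

  Selected : Fin (n G) → Fin (n G) → Set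
  Selected u v = p u < p v × Edge G u v × representative (p u) (p v) ≡ (u , v)

  selected? : ∀ u v → Dec (Selected u v)
  selected? u v = (p u <? p v) ×-dec T? (adj G u v)
    ×-dec Product.≡-dec _≟_ _≟_ (representative (p u) (p v)) (u , v)

  Selected-irrefl : ∀ u → ¬ Selected u u
  Selected-irrefl u (pu<pu , _) = <-irrefl refl pu<pu

  G′ : Graph
  G′ = symmetricClosure selected? Selected-irrefl

  Selected⇒Edge′ : ∀ {x y} → Selected x y → Edge G′ x y
  Selected⇒Edge′ s = Equivalence.from (Edge-symmetricClosure selected? Selected-irrefl) (inj₁ s)

  Selected⇒Edge′˘ : ∀ {x y} → Selected x y → Edge G′ y x
  Selected⇒Edge′˘ s = Equivalence.from (Edge-symmetricClosure selected? Selected-irrefl) (inj₂ s)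

  Edge′⇒Selected : ∀ {u v} → Edge G′ u v → Selected u v ⊎ Selected v u
  Edge′⇒Selected = Equivalence.to (Edge-symmetricClosure selected? Selected-irrefl)

  Edge′⇒Edge : ∀ {u v} → Edge G′ u v → Edge G u v
  Edge′⇒Edge {u} {v} e with Edge′⇒Selected e
  ... | inj₁ (_ , uv , _) = uv
  ... | inj₂ (_ , vu , _) = subst T (sym G v u) vu

  G′⊆G : IsSubgraph G′ G
  G′⊆G = (λ u → u) , (λ u≡v → u≡v) , λ _ _ → Edge′⇒Edge

  Selected⇒EdgeH : ∀ {x y} → Selected x y → p x < p y × Edge H (p x) (p y)
  Selected⇒EdgeH {x} {y} (px<py , xy , _) =
    px<py , Equivalence.from (EdgeH⇔ClassEdge (p x) (p y)) (<⇒≢ px<py , x , y , refl , refl , xy)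

  EdgeH⇒Selected : ∀ {a b} → a < b → Edge H a b →
    let (x , y) = representative a b in p x ≡ a × p y ≡ b × Selected x y
  EdgeH⇒Selected {a} {b} a<b ab
    with _ , u , v , c ← Equivalence.to (EdgeH⇔ClassEdge a b) ab
    with representative a b in rep | representative-classEdge c
  ... | x , y | refl , refl , xy = refl , refl , a<b , xy , rep

  classes-joined-in-G′ : ∀ {a b} → a ≢ b → Edge H a b →
    ∃[ u ] ∃[ v ] (p u ≡ a × p v ≡ b × Edge G′ u v)
  classes-joined-in-G′ {a} {b} a≢b ab with <-cmp a b
  ... | tri< a<b _ _ = let px , py , s = EdgeH⇒Selected a<b ab in _ , _ , px , py , Selected⇒Edge′ s
  ... | tri≈ _ a≡b _ = ⊥-elim (a≢b a≡b)
  ... | tri> _ _ b<a = let py , px , s = EdgeH⇒Selected b<a (subst T (sym H a b) ab)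
                       in _ , _ , px , py , Selected⇒Edge′˘ s

  G′-quotient : IsQuotient H G′
  G′-quotient = p , p-surjective , λ a b → mk⇔
    (λ ab → let a≢b , _ = Equivalence.to (EdgeH⇔ClassEdge a b) ab
            in a≢b , classes-joined-in-G′ a≢b ab)
    (λ (a≢b , u , v , pu , pv , uv) →
       Equivalence.from (EdgeH⇔ClassEdge a b) (a≢b , u , v , pu , pv , Edge′⇒Edge uv))

  classPair : Fin (n G) × Fin (n G) → Fin (n H) × Fin (n H)
  classPair (u , v) = sort₂ (p u , p v)

  representativeEdge : Fin (n H) × Fin (n H) → Fin (n G) × Fin (n G)
  representativeEdge (a , b) = sort₂ (representative a b)

  Selected⇒sorted-Edge′ : ∀ {x y} → Selected x y →
    let (u , v) = sort₂ (x , y) in u < v × Edge G′ u v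
  Selected⇒sorted-Edge′ {x} {y} s with <-cmp x y
  ... | tri< x<y _ _ = x<y , Selected⇒Edge′ s
  ... | tri≈ _ refl _ = ⊥-elim (Selected-irrefl x s)
  ... | tri> _ _ y<x = y<x , Selected⇒Edge′˘ s

  classPair-sort₂-Selected : ∀ {x y} → Selected x y → classPair (sort₂ (x , y)) ≡ (p x , p y)
  classPair-sort₂-Selected {x} {y} s with <-cmp x y
  ... | tri< _ _ _ = sort₂-< (proj₁ s)
  ... | tri≈ _ refl _ = ⊥-elim (Selected-irrefl x s)
  ... | tri> _ _ _ = sort₂-> (proj₁ s)

  Edge′⇒sort₂-Selected : ∀ {u v} → u < v → Edge G′ u v →
    ∃[ x ] ∃[ y ] (Selected x y × sort₂ (x , y) ≡ (u , v))
  Edge′⇒sort₂-Selected {u} {v} u<v uv with Edge′⇒Selected uv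
  ... | inj₁ s = u , v , s , sort₂-< u<v
  ... | inj₂ s = v , u , s , sort₂-> u<v

  numEdges-G′ : numEdges G′ ≡ numEdges H
  numEdges-G′ = length-filter-≡ _ _ (allPairs-unique (n G)) (allPairs-unique (n H))
    classPair representativeEdge
    (λ { {u , v} _ (u<v , uv) → ∈-allPairs _ , classPair-Edge′ u<v uv })
    (λ { {u , v} _ (u<v , uv) → representativeEdge-classPair u<v uv })
    (λ { {a , b} _ (a<b , ab) → ∈-allPairs _ , representativeEdge-EdgeH a<b ab })
    (λ { {a , b} _ (a<b , ab) → classPair-representativeEdge a<b ab })
    where
    allPairs-unique : ∀ m → Unique (cartesianProduct (allFin m) (allFin m))
    allPairs-unique m = Unique.cartesianProduct⁺ (Unique.allFin⁺ m) (Unique.allFin⁺ m)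

    ∈-allPairs : ∀ {m} (e : Fin m × Fin m) → e ∈ cartesianProduct (allFin m) (allFin m)
    ∈-allPairs (u , v) = ∈-cartesianProduct⁺ (∈-allFin u) (∈-allFin v)

    classPair-Edge′ : ∀ {u v} → u < v → Edge G′ u v →
      let (a , b) = classPair (u , v) in a < b × Edge H a b
    classPair-Edge′ u<v uv with Edge′⇒sort₂-Selected u<v uv
    ... | x , y , s , refl rewrite classPair-sort₂-Selected s = Selected⇒EdgeH s

    representativeEdge-classPair : ∀ {u v} → u < v → Edge G′ u v →
      representativeEdge (classPair (u , v)) ≡ (u , v)
    representativeEdge-classPair u<v uv with Edge′⇒sort₂-Selected u<v uv
    ... | x , y , s@(_ , _ , rep) , refl = begin
      representativeEdge (classPair (sort₂ (x , y)))
        ≡⟨ cong representativeEdge (classPair-sort₂-Selected s) ⟩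
      representativeEdge (p x , p y)
        ≡⟨ cong sort₂ rep ⟩
      sort₂ (x , y)
        ∎

    representativeEdge-EdgeH : ∀ {a b} → a < b → Edge H a b →
      let (u , v) = representativeEdge (a , b) in u < v × Edge G′ u v
    representativeEdge-EdgeH {a} {b} a<b ab with representative a b | EdgeH⇒Selected a<b ab
    ... | x , y | _ , _ , s = Selected⇒sorted-Edge′ s

    classPair-representativeEdge : ∀ {a b} → a < b → Edge H a b →
      classPair (representativeEdge (a , b)) ≡ (a , b)
    classPair-representativeEdge {a} {b} a<b ab with representative a b | EdgeH⇒Selected a<b ab
    ... | x , y | refl , refl , s = classPair-sort₂-Selected s

mainTheorem9 : (G H : Graph) → IsQuotient H G →
    Σ Graph λ G' → IsSubgraph G' G × numEdges G' ≡ numEdges H × IsQuotient H G'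
mainTheorem9 G H quotient = G′ , G′⊆G , numEdges-G′ , G′-quotient
  where open RepresentativeEdges G H quotient
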